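{- Let $X$ be an ample simplicial complex and let $L'\subset L$ be a finite simplicial complex $L$ together with an induced subcomplex $L'$. Let $f':L'\to X_{U'}$ be an isomorphism of simplicial complexes, where $U'\subset V(X)$ is a finite subset. Then there exist a finite subset $U\subset V(X)$ containing $U'$ and an isomorphism $f:L\to X_U$ with $f|_{L'}=f'$.
   Context: A simplicial complex $X$ consists of a vertex set $V(X)$ and a set of non-empty finite subsets of $V(X)$ (simplexes), closed under taking non-empty subsets and containing all singletons. For $U\subset V(X)$, $X_U$ denotes the induced subcomplex: vertex set $U$ and all simplexes of $X$ contained in $U$; a subcomplex is induced if it equals the induced subcomplex on its vertex set. The link ${\rm Lk}_X(v)$ of a vertex $v$ consists of all simplexes $\sigma$ with $v\notin\sigma$ and $\sigma\cup\{v\}$ a simplex of $X$. A countable simplicial complex $X$ is ample if for every finite $U\subset V(X)$ and every subcomplex $A\subset X_U$ (possibly empty) there is $v\in V(X)\setminus U$ with ${\rm Lk}_X(v)\cap X_U=A$. -}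

module Defs where

open import Data.Nat using (ℕ)
open import Data.Bool using (Bool; T)
open import Data.List using (List; []; _∷_; [_]; map)
open import Data.List.Membership.Propositional using (_∈_; _∉_)
open import Data.List.Membership.Propositional.Properties using (∈-map⁺; ∈-map⁻)
open import Data.List.Relation.Binary.Subset.Propositional using (_⊆_)
open import Data.List.Relation.Unary.All using (All)
open import Data.Product using (Σ; ∃; _×_; _,_; proj₁; proj₂)
open import Function using (_∘_; Injective)
open import Function.Bundles using (_↔_; Inverse; _⇔_)
open import Relation.Binary.PropositionalEquality using (_≡_; refl; subst; _≢_)
open import Relation.Nullary using (¬_)

-- A simplicial complex.  Finite subsets of vertices are represented by lists
-- (read as the set of their members); the simplex predicate is required to
-- depend only on that set.
record SC : Set₁ where
  field
    V        : Set
    Simplex  : List V → Set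
    nonempty : ∀ {σ} → Simplex σ → σ ≢ []
    sameSet  : ∀ {σ τ} → (∀ v → (v ∈ σ) ⇔ (v ∈ τ)) → Simplex σ → Simplex τ
    down     : ∀ {σ τ} → τ ⊆ σ → τ ≢ [] → Simplex σ → Simplex τ
    single   : ∀ v → Simplex [ v ]
open SC public

-- Subsets of vertices are (decidable) Bool-valued predicates; finiteness means
-- they are covered by a list.
FiniteSubset : {A : Set} → (A → Bool) → Set
FiniteSubset {A} U = ∃ λ (xs : List A) → ∀ v → T (U v) → v ∈ xs

FiniteSC : SC → Set
FiniteSC L = ∃ λ (xs : List (V L)) → ∀ v → v ∈ xs

Countable : SC → Set
Countable X = ∃ λ (c : V X → ℕ) → Injective _≡_ _≡_ c

private
  map-nonempty : {A B : Set} {f : A → B} {σ : List A} → map f σ ≢ [] → σ ≢ []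
  map-nonempty h refl = h refl

  map-⊆ : {A B : Set} {f : A → B} {σ τ : List A} → τ ⊆ σ → map f τ ⊆ map f σ
  map-⊆ {f = f} s x∈ with ∈-map⁻ f x∈
  ... | (y , y∈ , refl) = ∈-map⁺ f (s y∈)

  map-same : {A B : Set} {f : A → B} {σ τ : List A} →
             (∀ v → (v ∈ σ) ⇔ (v ∈ τ)) → ∀ w → (w ∈ map f σ) → (w ∈ map f τ)
  map-same {f = f} h w w∈ with ∈-map⁻ f w∈
  ... | (y , y∈ , refl) = ∈-map⁺ f (Function.Bundles.Equivalence.to (h y) y∈)

  sym⇔ : {A : Set} {σ τ : List A} → (∀ v → (v ∈ σ) ⇔ (v ∈ τ)) → (∀ v → (v ∈ τ) ⇔ (v ∈ σ))
  sym⇔ h v = record { to = Function.Bundles.Equivalence.from (h v)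
                    ; from = Function.Bundles.Equivalence.to (h v)
                    ; to-cong = λ { refl → refl } ; from-cong = λ { refl → refl } }

Induced : (X : SC) → (V X → Bool) → SC
Induced X U = record
  { V        = Σ (V X) (T ∘ U)
  ; Simplex  = λ σ → Simplex X (map proj₁ σ)
  ; nonempty = λ s → map-nonempty (nonempty X s)
  ; sameSet  = λ h s → sameSet X (λ w → record
                 { to = map-same h w ; from = map-same (sym⇔ h) w
                 ; to-cong = λ { refl → refl } ; from-cong = λ { refl → refl } }) s
  ; down     = λ s ne t → down X (map-⊆ s) (λ e → ne (map-nonempty' e)) t
  ; single   = λ v → single X (proj₁ v)
  }
  where
    map-nonempty' : ∀ {τ : List (Σ (V X) (T ∘ U))} → map proj₁ τ ≡ [] → τ ≡ []
    map-nonempty' {[]} _ = refl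
    map-nonempty' {_ ∷ _} ()

record Iso (K L : SC) : Set where
  field
    vbij     : V K ↔ V L
    simplex⇔ : ∀ σ → Simplex K σ ⇔ Simplex L (map (Inverse.to vbij) σ)
open Iso public

isoMap : {K L : SC} → Iso K L → V K → V L
isoMap f = Inverse.to (vbij f)

record SubcomplexOf (X : SC) (U : V X → Bool) : Set₁ where
  field
    ASimplex  : List (V X) → Set
    inX       : ∀ {σ} → ASimplex σ → Simplex X σ
    inU       : ∀ {σ} → ASimplex σ → All (T ∘ U) σ
    Anonempty : ∀ {σ} → ASimplex σ → σ ≢ []
    AsameSet  : ∀ {σ τ} → (∀ v → (v ∈ σ) ⇔ (v ∈ τ)) → ASimplex σ → ASimplex τ
    Adown     : ∀ {σ τ} → τ ⊆ σ → τ ≢ [] → ASimplex σ → ASimplex τ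
open SubcomplexOf public

-- σ is a simplex of Lk_X(v) ∩ X_U.
LinkInU : (X : SC) → V X → (V X → Bool) → List (V X) → Set
LinkInU X v U σ = (σ ≢ []) × (v ∉ σ) × Simplex X (v ∷ σ) × Simplex X σ × All (T ∘ U) σ

Ample : SC → Set₁
Ample X = Countable X ×
  (∀ (U : V X → Bool) → FiniteSubset U → (A : SubcomplexOf X U) →
     ∃ λ (v : V X) → ¬ T (U v) ×
       (∀ σ → LinkInU X v U σ ⇔ ASimplex A σ))

module Submission where

-- The extension property of ample complexes, proved one vertex at a time.
--
-- We work with a vertex map φ : V(L) → V(X) together with a predicate P on
-- V(L) and a finite predicate U on V(X) such that φ restricts to an
-- isomorphism L_P ≅ X_U ('IsoOn').  The given isomorphism f' : L_{P} ≅ X_{U'}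
-- is such a triple, and a triple with P total is an isomorphism L ≅ X_U.
--
-- Extension step: for y ∉ P, the image under φ of Lk_L(y) ∩ L_P is a
-- subcomplex A of X_U ('linkImage').  Ampleness gives a vertex u ∉ U with
-- Lk_X(u) ∩ X_U = A, and redefining φ(y) = u extends the isomorphism to
-- L_{P ∪ {y}} ≅ X_{U ∪ {u}}: a simplex through y is a cone y ∗ σ, and
-- y ∗ σ ∈ L  ⇔  φ σ ∈ A  ⇔  u ∗ φ σ ∈ X  ('cone').
--
-- Iterating the step over a finite listing of V(L) proves the theorem.
-- Decidable equality on both vertex sets (needed to redefine maps at a
-- point and to filter simplexes) comes from finiteness of L and countability
-- of X.

open import Defs
open import Data.Bool using (Bool; T; false; _∨_)
open import Data.Bool.Properties using (T-irrelevant; T-∨)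
open import Data.Fin using () renaming (_≟_ to _≟Fin_)
open import Data.Nat.Properties using (eq?)
open import Data.List using (List; []; _∷_; map; filter)
open import Data.List.Properties using (map-∘; map-cong-local)
open import Data.List.Membership.Propositional using (_∈_; _∉_)
open import Data.List.Membership.Propositional.Properties
  using (∈-map⁺; ∈-map⁻; ∈-filter⁺; ∈-filter⁻; ∉[])
open import Data.List.Membership.Setoid.Properties using (index-injective)
import Data.List.Membership.DecPropositional as DecMembership
open import Data.List.Relation.Unary.Any using (here; there; index)
open import Data.List.Relation.Unary.All as All using (All; []; _∷_)
open import Data.List.Relation.Unary.All.Properties using () renaming (map⁺ to All-map⁺)
open import Data.List.Relation.Binary.Subset.Propositional using (_⊆_)
open import Data.List.Relation.Binary.Subset.Propositional.Properties
  using (⊆[]⇒≡[]; All-resp-⊇; map⁺; ∷⁺ʳ; xs⊆x∷xs; filter-⊆)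
open import Data.Product using (Σ; ∃; _×_; _,_; proj₁; proj₂)
open import Data.Sum using (_⊎_; inj₁; inj₂; [_,_]′)
import Data.Sum as Sum
open import Data.Empty using (⊥; ⊥-elim)
open import Function using (_∘_; id; Injective)
open import Function.Bundles using (Inverse; Injection; _↔_; _⇔_; mk⇔; mk↔ₛ′; mk↣; Equivalence)
open import Function.Properties.Equivalence using (⇔-setoid)
open import Function.Properties.Inverse using (↔⇒↣)
open import Level using (0ℓ)
open import Relation.Binary.Definitions using (DecidableEquality)
open import Relation.Binary.PropositionalEquality
  using (_≡_; _≢_; refl; sym; trans; cong; cong₂; subst; setoid)
open import Relation.Nullary using (¬_; Dec; yes; no; ¬?)
open import Relation.Nullary.Decidable using (⌊_⌋; toWitness; fromWitness; T?; decidable-stable; via-injection)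

open Equivalence using (to; from)

private
  variable
    A B : Set
    σ τ : List A

SameSet : List A → List A → Set
SameSet σ τ = ∀ v → (v ∈ σ) ⇔ (v ∈ τ)

⊆⇒SameSet : σ ⊆ τ → τ ⊆ σ → SameSet σ τ
⊆⇒SameSet σ⊆τ τ⊆σ v = mk⇔ σ⊆τ τ⊆σ

SameSet⇒⊆ : SameSet σ τ → σ ⊆ τ
SameSet⇒⊆ σ≈τ {v} = to (σ≈τ v)

SameSet⇒⊇ : SameSet σ τ → τ ⊆ σ
SameSet⇒⊇ σ≈τ {v} = from (σ≈τ v)

simplex-cong : (K : SC) {σ τ : List (V K)} → σ ⊆ τ → τ ⊆ σ → Simplex K σ ⇔ Simplex K τ
simplex-cong K σ⊆τ τ⊆σ =
  mk⇔ (sameSet K (⊆⇒SameSet σ⊆τ τ⊆σ)) (sameSet K (⊆⇒SameSet τ⊆σ σ⊆τ))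

nonempty-⊆ : σ ≢ [] → σ ⊆ τ → τ ≢ []
nonempty-⊆ σ≢[] σ⊆τ refl = σ≢[] (⊆[]⇒≡[] σ⊆τ)

-- A type listed completely by a list has decidable equality (compare positions).
finite⇒decEq : (xs : List A) → (∀ v → v ∈ xs) → DecidableEquality A
finite⇒decEq xs complete = via-injection (mk↣ position-injective) _≟Fin_
  where
    position-injective : Injective _≡_ _≡_ (λ v → index (complete v))
    position-injective {v} {w} = index-injective (setoid _) (complete v) (complete w)

InjectiveOn : (A → Set) → (A → B) → Set
InjectiveOn Q φ = ∀ {v w} → Q v → Q w → φ v ≡ φ w → v ≡ w

map-⊆-reflect : {Q : A → Set} {φ : A → B} → InjectiveOn Q φ →
                All Q σ → All Q τ → map φ σ ⊆ map φ τ → σ ⊆ τ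
map-⊆-reflect {τ = τ} {φ = φ} injective Qσ Qτ image⊆ v∈σ
  with ∈-map⁻ φ (image⊆ (∈-map⁺ φ v∈σ))
... | w , w∈τ , φv≡φw =
  subst (_∈ τ) (sym (injective (All.lookup Qσ v∈σ) (All.lookup Qτ w∈τ) φv≡φw)) w∈τ

preimage : DecidableEquality B → (φ : A → B) (σ : List A) (τ : List B) → τ ⊆ map φ σ →
           Σ (List A) λ σ' → σ' ⊆ σ × SameSet τ (map φ σ')
preimage {A = A} _≟_ φ σ τ τ⊆φσ = filter hits? σ , filter-⊆ hits? σ , ⊆⇒SameSet covered hits
  where
    open DecMembership _≟_ using (_∈?_)
    hits? : (v : A) → Dec (φ v ∈ τ)
    hits? v = φ v ∈? τ

    covered : τ ⊆ map φ (filter hits? σ)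
    covered x∈τ with ∈-map⁻ φ (τ⊆φσ x∈τ)
    ... | v , v∈σ , refl = ∈-map⁺ φ (∈-filter⁺ hits? v∈σ x∈τ)

    hits : map φ (filter hits? σ) ⊆ τ
    hits x∈image with ∈-map⁻ φ x∈image
    ... | v , v∈filtered , refl = proj₂ (∈-filter⁻ hits? {xs = σ} v∈filtered)

remove : DecidableEquality A → A → List A → List A
remove _≟_ y = filter (λ v → ¬? (v ≟ y))

module _ (_≟_ : DecidableEquality A) {y : A} where

  remove-≢ : ∀ {v} → v ∈ remove _≟_ y σ → v ≢ y
  remove-≢ {σ = σ} v∈ = proj₂ (∈-filter⁻ (λ v → ¬? (v ≟ y)) {xs = σ} v∈)

  remove-⊆ : σ ⊆ y ∷ remove _≟_ y σ
  remove-⊆ {x = v} v∈σ with v ≟ y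
  ... | yes v≡y = here v≡y
  ... | no v≢y = there (∈-filter⁺ (λ v → ¬? (v ≟ y)) v∈σ v≢y)

  remove-⊇ : y ∈ σ → y ∷ remove _≟_ y σ ⊆ σ
  remove-⊇ y∈σ (here refl) = y∈σ
  remove-⊇ {σ = σ} _ (there v∈) = filter-⊆ (λ v → ¬? (v ≟ y)) σ v∈

insert : DecidableEquality A → A → (A → Bool) → A → Bool
insert _≟_ y P v = P v ∨ ⌊ v ≟ y ⌋

module _ (_≟_ : DecidableEquality A) {y : A} {P : A → Bool} where

  T-insert : ∀ {v} → T (insert _≟_ y P v) ⇔ (T (P v) ⊎ v ≡ y)
  T-insert {v} = mk⇔ (Sum.map₂ toWitness ∘ to (T-∨ {P v}))
                     (from (T-∨ {P v}) ∘ Sum.map₂ fromWitness)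

  insert-old : ∀ {v} → T (P v) → T (insert _≟_ y P v)
  insert-old = from T-insert ∘ inj₁

  insert-new : T (insert _≟_ y P y)
  insert-new = from T-insert (inj₂ refl)

  insert-finite : FiniteSubset P → FiniteSubset (insert _≟_ y P)
  insert-finite (xs , P⊆xs) = y ∷ xs , λ v → [ there ∘ P⊆xs v , here ]′ ∘ to T-insert

update : DecidableEquality A → A → B → (A → B) → A → B
update _≟_ y b φ v with v ≟ y
... | yes _ = b
... | no _ = φ v

module _ (_≟_ : DecidableEquality A) {y : A} {b : B} {φ : A → B} where

  update-new : update _≟_ y b φ y ≡ b
  update-new with y ≟ y
  ... | yes _ = refl
  ... | no y≢y = ⊥-elim (y≢y refl)

  update-old : ∀ {v} → v ≢ y → update _≟_ y b φ v ≡ φ v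
  update-old {v} v≢y with v ≟ y
  ... | yes v≡y = ⊥-elim (v≢y v≡y)
  ... | no _ = refl

subset-≡ : {P : A → Bool} {x y : Σ A (T ∘ P)} → proj₁ x ≡ proj₁ y → x ≡ y
subset-≡ {x = a , p} {y = .a , q} refl = cong (a ,_) (T-irrelevant p q)

record IsoOn (L X : SC) (P : V L → Bool) (U : V X → Bool) (φ : V L → V X) : Set where
  field
    injective : InjectiveOn (T ∘ P) φ
    mapsInto  : ∀ {v} → T (P v) → T (U (φ v))
    onto      : ∀ {x} → T (U x) → ∃ λ v → T (P v) × φ v ≡ x
    preserves : ∀ σ → All (T ∘ P) σ → Simplex L σ ⇔ Simplex X (map φ σ)

  image-in-U : All (T ∘ P) σ → All (T ∘ U) (map φ σ)
  image-in-U = All-map⁺ ∘ All.map mapsInto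

module FromIso (L X : SC) {P : V L → Bool} {U : V X → Bool}
               (f : Iso (Induced L P) (Induced X U)) (x₀ : V X) where

  φ : V L → V X
  φ v with T? (P v)
  ... | yes p = proj₁ (isoMap f (v , p))
  ... | no _ = x₀

  φ-agrees : ∀ v (p : T (P v)) → φ v ≡ proj₁ (isoMap f (v , p))
  φ-agrees v p with T? (P v)
  ... | yes q = cong (λ q → proj₁ (isoMap f (v , q))) (T-irrelevant q p)
  ... | no ¬p = ⊥-elim (¬p p)

  lift : ∀ {σ} → All (T ∘ P) σ → List (V (Induced L P))
  lift = All.toList

  lift-vertices : ∀ {σ} (Pσ : All (T ∘ P) σ) → map proj₁ (lift Pσ) ≡ σ
  lift-vertices [] = refl
  lift-vertices (_ ∷ Pσ) = cong (_ ∷_) (lift-vertices Pσ)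

  lift-image : ∀ {σ} (Pσ : All (T ∘ P) σ) → map proj₁ (map (isoMap f) (lift Pσ)) ≡ map φ σ
  lift-image [] = refl
  lift-image {v ∷ _} (p ∷ Pσ) = cong₂ _∷_ (sym (φ-agrees v p)) (lift-image Pσ)

  isoOn : IsoOn L X P U φ
  isoOn = record
    { injective = λ {v} {w} pv pw φv≡φw → cong proj₁ (Injection.injective (↔⇒↣ (vbij f)) (subset-≡
        (trans (sym (φ-agrees v pv)) (trans φv≡φw (φ-agrees w pw)))))
    ; mapsInto  = λ {v} p → subst (T ∘ U) (sym (φ-agrees v p)) (proj₂ (isoMap f (v , p)))
    ; onto      = λ {x} u → let (v , p) = Inverse.from (vbij f) (x , u) in
        v , p , trans (φ-agrees v p) (cong proj₁ (Inverse.strictlyInverseˡ (vbij f) (x , u)))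
    ; preserves = λ σ Pσ →
        subst (λ s → Simplex L s ⇔ Simplex X (map φ σ)) (lift-vertices Pσ)
          (subst (Simplex L (map proj₁ (lift Pσ)) ⇔_) (cong (Simplex X) (lift-image Pσ))
            (simplex⇔ f (lift Pσ)))
    }

toIso : {L X : SC} {P : V L → Bool} {U : V X → Bool} {φ : V L → V X} →
        IsoOn L X P U φ → (∀ v → T (P v)) →
        Σ (Iso L (Induced X U)) λ f → ∀ v → proj₁ (isoMap f v) ≡ φ v
toIso {L} {X} {P} {U} {φ} iso total = record { vbij = bijection ; simplex⇔ = preserves′ } , λ _ → refl
  where
    open IsoOn iso
    bijection : V L ↔ Σ (V X) (T ∘ U)
    bijection = mk↔ₛ′ (λ v → φ v , mapsInto (total v)) (λ (x , u) → proj₁ (onto u))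
      (λ (x , u) → subset-≡ (proj₂ (proj₂ (onto u))))
      (λ v → let (w , p , φw≡φv) = onto (mapsInto (total v)) in injective p (total v) φw≡φv)
    preserves′ : ∀ σ → Simplex L σ ⇔ Simplex X (map proj₁ (map (Inverse.to bijection) σ))
    preserves′ σ = subst (λ s → Simplex L σ ⇔ Simplex X s) (map-∘ σ)
                     (preserves σ (All.tabulate λ {v} _ → total v))

ExtensionProperty : SC → Set₁
ExtensionProperty X = ∀ (U : V X → Bool) → FiniteSubset U → (A : SubcomplexOf X U) →
  ∃ λ (v : V X) → ¬ T (U v) × (∀ σ → LinkInU X v U σ ⇔ ASimplex A σ)

emptySubcomplex : (X : SC) → SubcomplexOf X (λ _ → false)
emptySubcomplex X = record
  { ASimplex = λ _ → ⊥ ; inX = λ () ; inU = λ () ; Anonempty = λ ()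
  ; AsameSet = λ _ () ; Adown = λ _ _ () }

ample-vertex : (X : SC) → ExtensionProperty X → V X
ample-vertex X extend = proj₁ (extend (λ _ → false) ([] , λ _ ()) (emptySubcomplex X))

module Extension (L X : SC) (_≟L_ : DecidableEquality (V L)) (_≟X_ : DecidableEquality (V X)) where

  module Link {P : V L → Bool} {U : V X → Bool} {φ : V L → V X}
              (iso : IsoOn L X P U φ) (y : V L) where
    open IsoOn iso

    -- τ is, as a set, the image φ σ of a simplex σ ⊆ P of Lk_L(y).
    LinkImage : List (V X) → Set
    LinkImage τ = τ ≢ [] ×
      Σ (List (V L)) λ σ → All (T ∘ P) σ × SameSet τ (map φ σ) × Simplex L (y ∷ σ)

    linkImage : SubcomplexOf X U
    linkImage = record
      { ASimplex  = LinkImage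
      ; inX       = λ (τ≢[] , σ , Pσ , τ≈φσ , yσ) →
          let σ≢[] : σ ≢ []
              σ≢[] = λ { refl → nonempty-⊆ τ≢[] (SameSet⇒⊆ τ≈φσ) refl } in
          sameSet X (⊆⇒SameSet (SameSet⇒⊇ τ≈φσ) (SameSet⇒⊆ τ≈φσ))
            (to (preserves σ Pσ) (down L (xs⊆x∷xs σ y) σ≢[] yσ))
      ; inU       = λ (_ , σ , Pσ , τ≈φσ , _) → All-resp-⊇ (SameSet⇒⊆ τ≈φσ) (image-in-U Pσ)
      ; Anonempty = proj₁
      ; AsameSet  = λ τ≈τ' (τ≢[] , σ , Pσ , τ≈φσ , yσ) →
          nonempty-⊆ τ≢[] (SameSet⇒⊆ τ≈τ') , σ , Pσ ,
          ⊆⇒SameSet (SameSet⇒⊆ τ≈φσ ∘ SameSet⇒⊇ τ≈τ') (SameSet⇒⊆ τ≈τ' ∘ SameSet⇒⊇ τ≈φσ) , yσ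
      ; Adown     = λ {_} {τ'} τ'⊆τ τ'≢[] (_ , σ , Pσ , τ≈φσ , yσ) →
          let (σ' , σ'⊆σ , τ'≈φσ') = preimage _≟X_ φ σ τ' (SameSet⇒⊆ τ≈φσ ∘ τ'⊆τ) in
          τ'≢[] , σ' , All-resp-⊇ σ'⊆σ Pσ , τ'≈φσ' , down L (∷⁺ʳ y σ'⊆σ) (λ ()) yσ
      }

  module AddVertex {P : V L → Bool} {U : V X → Bool} {φ : V L → V X}
                   (iso : IsoOn L X P U φ) {y : V L} (y∉P : ¬ T (P y))
                   {u : V X} (u∉U : ¬ T (U u))
                   (link : ∀ τ → LinkInU X u U τ ⇔ ASimplex (Link.linkImage iso y) τ) where
    open IsoOn iso

    P⁺ : V L → Bool
    P⁺ = insert _≟L_ y P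

    U⁺ : V X → Bool
    U⁺ = insert _≟X_ u U

    φ⁺ : V L → V X
    φ⁺ = update _≟L_ y u φ

    P⁺-cases : ∀ {v} → T (P⁺ v) → T (P v) ⊎ v ≡ y
    P⁺-cases = to (T-insert _≟L_ {y} {P})

    U⁺-cases : ∀ {x} → T (U⁺ x) → T (U x) ⊎ x ≡ u
    U⁺-cases = to (T-insert _≟X_ {u} {U})

    φ⁺-new : φ⁺ y ≡ u
    φ⁺-new = update-new _≟L_ {y} {u} {φ}

    old≢y : ∀ {v} → T (P v) → v ≢ y
    old≢y p refl = y∉P p

    φ⁺-old : ∀ {v} → T (P v) → φ⁺ v ≡ φ v
    φ⁺-old = update-old _≟L_ {y} {u} {φ} ∘ old≢y

    φ-avoids-u : ∀ {v} → T (P v) → φ v ≢ u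
    φ-avoids-u p φv≡u = u∉U (subst (T ∘ U) φv≡u (mapsInto p))

    -- The key fact: y ∗ σ ∈ L  ⇔  φ σ ∈ Lk_X(u) ∩ X_U  ⇔  u ∗ φ σ ∈ X.
    cone : ∀ σ → All (T ∘ P) σ → Simplex L (y ∷ σ) ⇔ Simplex X (u ∷ map φ σ)
    cone [] _ = mk⇔ (λ _ → single X u) (λ _ → single L y)
    cone σ@(_ ∷ _) Pσ = mk⇔ forward backward
      where
        φσ : List (V X)
        φσ = map φ σ

        φσ≢[] : φσ ≢ []
        φσ≢[] ()

        forward : Simplex L (y ∷ σ) → Simplex X (u ∷ φσ)
        forward yσ = proj₁ (proj₂ (proj₂ (from (link φσ) (φσ≢[] , σ , Pσ , ⊆⇒SameSet id id , yσ))))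

        u∉φσ : u ∉ φσ
        u∉φσ u∈φσ = u∉U (All.lookup (image-in-U Pσ) u∈φσ)

        backward : Simplex X (u ∷ φσ) → Simplex L (y ∷ σ)
        backward uφσ with to (link φσ) (φσ≢[] , u∉φσ , uφσ , down X (xs⊆x∷xs φσ u) φσ≢[] uφσ , image-in-U Pσ)
        ... | _ , σ' , Pσ' , φσ≈φσ' , yσ' =
          down L (∷⁺ʳ y (map-⊆-reflect injective Pσ Pσ' (SameSet⇒⊆ φσ≈φσ'))) (λ ()) yσ'

    -- The four conditions of 'IsoOn' for the extended data; the first three
    -- hold because u ∉ U = φ(P), the last reduces to 'cone'.
    injective⁺ : InjectiveOn (T ∘ P⁺) φ⁺
    injective⁺ {v} {w} pv pw φ⁺v≡φ⁺w with P⁺-cases pv | P⁺-cases pw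
    ... | inj₁ p | inj₁ q = injective p q (trans (sym (φ⁺-old p)) (trans φ⁺v≡φ⁺w (φ⁺-old q)))
    ... | inj₁ p | inj₂ refl =
      ⊥-elim (φ-avoids-u p (trans (sym (φ⁺-old p)) (trans φ⁺v≡φ⁺w φ⁺-new)))
    ... | inj₂ refl | inj₁ q =
      ⊥-elim (φ-avoids-u q (trans (sym (φ⁺-old q)) (trans (sym φ⁺v≡φ⁺w) φ⁺-new)))
    ... | inj₂ refl | inj₂ refl = refl

    mapsInto⁺ : ∀ {v} → T (P⁺ v) → T (U⁺ (φ⁺ v))
    mapsInto⁺ pv with P⁺-cases pv
    ... | inj₁ p = subst (T ∘ U⁺) (sym (φ⁺-old p)) (insert-old _≟X_ {u} {U} (mapsInto p))
    ... | inj₂ refl = subst (T ∘ U⁺) (sym φ⁺-new) (insert-new _≟X_ {u} {U})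

    onto⁺ : ∀ {x} → T (U⁺ x) → ∃ λ v → T (P⁺ v) × φ⁺ v ≡ x
    onto⁺ ux with U⁺-cases ux
    ... | inj₁ x∈U = let (v , p , φv≡x) = onto x∈U in
      v , insert-old _≟L_ {y} {P} p , trans (φ⁺-old p) φv≡x
    ... | inj₂ refl = y , insert-new _≟L_ {y} {P} , φ⁺-new

    preserves⁺ : ∀ σ → All (T ∘ P⁺) σ → Simplex L σ ⇔ Simplex X (map φ⁺ σ)
    preserves⁺ σ P⁺σ with DecMembership._∈?_ _≟L_ y σ
    ... | no y∉σ = subst (Simplex L σ ⇔_) (cong (Simplex X) (sym φ⁺σ≡φσ)) (preserves σ Pσ)
      where
        Pσ : All (T ∘ P) σ
        Pσ = All.tabulate λ v∈σ →
          [ id , (λ { refl → ⊥-elim (y∉σ v∈σ) }) ]′ (P⁺-cases (All.lookup P⁺σ v∈σ))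
        φ⁺σ≡φσ : map φ⁺ σ ≡ map φ σ
        φ⁺σ≡φσ = map-cong-local (All.map φ⁺-old Pσ)
    ... | yes y∈σ = begin
        Simplex L σ                   ≈⟨ simplex-cong L (remove-⊆ _≟L_) (remove-⊇ _≟L_ y∈σ) ⟩
        Simplex L (y ∷ σ₀)            ≈⟨ cone σ₀ Pσ₀ ⟩
        Simplex X (u ∷ map φ σ₀)      ≡⟨ cong (Simplex X) (sym φ⁺yσ₀) ⟩
        Simplex X (map φ⁺ (y ∷ σ₀))   ≈⟨ simplex-cong X (map⁺ φ⁺ (remove-⊇ _≟L_ y∈σ))
                                                         (map⁺ φ⁺ (remove-⊆ _≟L_)) ⟩
        Simplex X (map φ⁺ σ)          ∎
      where
        open import Relation.Binary.Reasoning.Setoid (⇔-setoid 0ℓ)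
        σ₀ : List (V L)
        σ₀ = remove _≟L_ y σ

        Pσ₀ : All (T ∘ P) σ₀
        Pσ₀ = All.tabulate λ v∈σ₀ →
          [ id , (λ v≡y → ⊥-elim (remove-≢ _≟L_ {σ = σ} v∈σ₀ v≡y)) ]′
            (P⁺-cases (All.lookup P⁺σ (filter-⊆ _ σ v∈σ₀)))

        φ⁺yσ₀ : map φ⁺ (y ∷ σ₀) ≡ u ∷ map φ σ₀
        φ⁺yσ₀ = cong₂ _∷_ φ⁺-new (map-cong-local (All.map φ⁺-old Pσ₀))

    isoOn⁺ : IsoOn L X P⁺ U⁺ φ⁺
    isoOn⁺ = record
      { injective = injective⁺ ; mapsInto = mapsInto⁺ ; onto = onto⁺ ; preserves = preserves⁺ }

  addVertex : ExtensionProperty X →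
              ∀ {P U φ} → IsoOn L X P U φ → FiniteSubset U → ∀ y → ¬ T (P y) →
              ∃ λ u → IsoOn L X (insert _≟L_ y P) (insert _≟X_ u U) (update _≟L_ y u φ)
  addVertex extend iso finU y y∉P =
    let (u , u∉U , link) = extend _ finU (Link.linkImage iso y) in
    u , AddVertex.isoOn⁺ iso y∉P u∉U link

  Extended : (V L → Bool) → (V X → Bool) → (V L → V X) → Set
  Extended P U φ = Σ (V X → Bool) λ U' → Σ (Iso L (Induced X U')) λ f →
    FiniteSubset U' × (∀ x → T (U x) → T (U' x)) × (∀ v → T (P v) → proj₁ (isoMap f v) ≡ φ v)

  shrink-cover : ∀ {P P' : V L → Bool} {y ys} → (∀ v → T (P v) → T (P' v)) → T (P' y) →
                 (∀ v → ¬ T (P v) → v ∈ y ∷ ys) → ∀ v → ¬ T (P' v) → v ∈ ys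
  shrink-cover P⊆P' y∈P' cover v v∉P' with cover v (v∉P' ∘ P⊆P' v)
  ... | here refl = ⊥-elim (v∉P' y∈P')
  ... | there v∈ys = v∈ys

  extendAll : ExtensionProperty X → (ys : List (V L)) → ∀ {P U φ} →
              IsoOn L X P U φ → FiniteSubset U → (∀ v → ¬ T (P v) → v ∈ ys) → Extended P U φ
  extendAll _ [] {P} {U} iso finU cover =
    let (f , f≡φ) = toIso iso total in U , f , finU , (λ _ → id) , λ v _ → f≡φ v
    where
      total : ∀ v → T (P v)
      total v = decidable-stable (T? (P v)) (∉[] ∘ cover v)
  extendAll extend (y ∷ ys) {P} {U} {φ} iso finU cover with T? (P y)
  ... | yes y∈P = extendAll extend ys iso finU (shrink-cover (λ _ → id) y∈P cover)
  ... | no y∉P =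
    let (u , iso⁺) = addVertex extend iso finU y y∉P
        (U' , f , finU' , U⁺⊆U' , f≡φ⁺) =
          extendAll extend ys iso⁺ (insert-finite _≟X_ finU)
            (shrink-cover (λ _ → insert-old _≟L_ {y} {P}) (insert-new _≟L_ {y} {P}) cover)
    in U' , f , finU' , (λ x → U⁺⊆U' x ∘ insert-old _≟X_ {u} {U}) ,
       λ v p → trans (f≡φ⁺ v (insert-old _≟L_ {y} {P} p))
                     (update-old _≟L_ {y} {u} {φ} (λ { refl → y∉P p }))

mainTheorem3 : (X : SC) → Ample X →
    (L : SC) → FiniteSC L → (P : V L → Bool) →
    (U' : V X → Bool) → FiniteSubset U' →
    (f' : Iso (Induced L P) (Induced X U')) →
    Σ (V X → Bool) λ U → FiniteSubset U × (∀ v → T (U' v) → T (U v)) ×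
    Σ (Iso L (Induced X U)) λ f →
    ∀ (w : V (Induced L P)) → proj₁ (isoMap f (proj₁ w)) ≡ proj₁ (isoMap f' w)
mainTheorem3 X ((code , code-injective) , extend) L (vs , complete) P U' finU' f' =
  let (U , f , finU , U'⊆U , f≡φ) = extendAll extend vs isoOn finU' (λ v _ → complete v)
  in U , finU , U'⊆U , f , λ (v , p) → trans (f≡φ v p) (φ-agrees v p)
  where
    -- Finiteness of L and countability of X give decidable equality of vertices;
    -- the given isomorphism, extended off P by any vertex, is the starting point.
    open Extension L X (finite⇒decEq vs complete) (eq? (mk↣ code-injective))
    open FromIso L X f' (ample-vertex X extend)
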